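{- Let $n\ge1$, let $e$ be an integer-valued function on the positive divisors of $n$, and for $k\in\mathbb Z$ set $m(k)=\sum_{d\mid (k,n)}e(n/d)$ and $p(k)=\sum_{d\mid(k,n)}d\,e(d)$. Then for all complex $s$, $$\sum_{d\mid n}m\Big(\frac nd\Big)\phi_{1-s}(d)=\sum_{d\mid n}\frac{d\,e(d)}{d^s},\qquad \frac1n\sum_{d\mid n}p\Big(\frac nd\Big)\phi_{1-s}(d)=\sum_{d\mid n}\frac{e(n/d)}{d^s},$$ and equivalently $$\sum_{d\mid n}m\Big(\frac nd\Big)\phi_{ -s}(d)=\sum_{d\mid n}\frac{e(d)}{d^s},\qquad \sum_{d\mid n}p\Big(\frac nd\Big)\phi_{ -s}(d)=\sum_{d\mid n}\frac{(n/d)\,e(n/d)}{d^s}.$$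
   Context: $(k,n)$ is the greatest common divisor, with $(0,n)=n$. For a positive integer $d$ and complex $s$, $\phi_s(d)=\sum_{d'\mid d}\mu(d/d')\,d'^{\,s}$, where $\mu$ is the Möbius function. (Here $m(k)$ is the multiplicity of the root $e^{2\pi i k/n}$ and $p(k)$ the sum of $k$-th powers of the roots of $\prod_{d\mid n}(q^d-1)^{e(d)}$.) -}

module Defs where

open import Level using (Level)
open import Data.Bool using (Bool; true; false; if_then_else_)
open import Data.Nat as ℕ using (ℕ; zero; suc; _∸_)
open import Data.Nat.Divisibility using (_∣_; _∣?_)
open import Data.Nat.Primality using (prime?)
open import Data.Nat.GCD using (gcd)
open import Data.Nat.DivMod using (_/_)
open import Data.Integer as ℤ using (ℤ; +_; -[1+_])
open import Data.List using (List; []; _∷_; map; filter; upTo; length; foldr)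
open import Data.Bool.ListAction using (any)
open import Data.Product using () renaming (_×_ to _∧_)
open import Relation.Nullary.Decidable using (does; _×-dec_)
open import Algebra.Bundles using (CommutativeRing)

divisors : ℕ → List ℕ
divisors n = filter (λ d → d ∣? n) (map suc (upTo n))

-- Exact quotient a / b for b ≥ 1 (b = 0 never occurs in our uses; returns 0).
quot : ℕ → ℕ → ℕ
quot a zero    = 0
quot a (suc b) = a / suc b

sumDivℤ : ℕ → (ℕ → ℤ) → ℤ
sumDivℤ n f = foldr (λ d acc → f d ℤ.+ acc) (+ 0) (divisors n)

-- Möbius function (standard definition): μ(n) = 0 if p² ∣ n for some prime p
-- (equivalently k² ∣ n for some k ≥ 2), otherwise (-1)^(number of prime divisors).
μ : ℕ → ℤ
μ n =
  if any (λ k → does ((k ℕ.* k) ∣? n)) (map (λ i → suc (suc i)) (upTo n))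
  then + 0
  else -[1+ 0 ] ℤ.^ length (filter (λ p → prime? p ×-dec p ∣? n) (upTo (suc n)))

mult : (n : ℕ) → (ℕ → ℤ) → ℕ → ℤ
mult n e k = sumDivℤ (gcd k n) (λ d → e (quot n d))

psum : (n : ℕ) → (ℕ → ℤ) → ℕ → ℤ
psum n e k = sumDivℤ (gcd k n) (λ d → + d ℤ.* e d)

module _ {c ℓ : Level} (R : CommutativeRing c ℓ) where
  open CommutativeRing R
  open import Algebra.Definitions.RawMonoid +-rawMonoid using (_×_)

  fromℤ : ℤ → Carrier
  fromℤ (+ n)      = n × 1#
  fromℤ -[1+ n ]   = - (suc n × 1#)

  fromℕ : ℕ → Carrier
  fromℕ n = n × 1#

  sumDiv : ℕ → (ℕ → Carrier) → Carrier
  sumDiv n f = foldr (λ d acc → f d + acc) 0# (divisors n)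

  -- χ plays the role of d ↦ d^(-s): a completely multiplicative function on
  -- the positive integers with χ(1) = 1.
  CompletelyMultiplicative : (ℕ → Carrier) → Set ℓ
  CompletelyMultiplicative χ =
    (χ 1 ≈ 1#) ∧ (∀ a b → χ (suc a ℕ.* suc b) ≈ χ (suc a) * χ (suc b))

  φ₋ : (ℕ → Carrier) → ℕ → Carrier
  φ₋ χ d = sumDiv d (λ d′ → fromℤ (μ (quot d d′)) * χ d′)

  φ₁₋ : (ℕ → Carrier) → ℕ → Carrier
  φ₁₋ χ d = sumDiv d (λ d′ → fromℤ (μ (quot d d′)) * (fromℕ d′ * χ d′))

-- For k ∣ n we have gcd(k, n) = k, so on the divisors of n the functions m and p are the Dirichlet
-- convolutions 𝟙 ⋆ E and 𝟙 ⋆ P, where E(d) = e(n/d) and P(d) = d·e(d); and φ₋ = χ ⋆ μ,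
-- φ₁₋ = χ₁ ⋆ μ with χ₁(d) = d·χ(d).  Every left-hand side is therefore ((G ⋆ μ) ⋆ (𝟙 ⋆ A))(n),
-- which equals (G ⋆ A)(n) because μ ⋆ 𝟙 = δ; writing out G ⋆ A gives the right-hand sides.
-- A convolution is encoded as the double sum over 1 ≤ a, b ≤ n of [ab = n]·f(a)·g(b), so that
-- associativity is an exchange of finite sums.  The identity μ ⋆ 𝟙 = δ at k ≥ 2 comes from
-- pairing each divisor j of k prime to a prime p ∣ k with p·j, using μ(pj) = -μ(j) for p ∤ j
-- and μ(pj) = 0 for p ∣ j.

module Submission where

open import Defs
open import Algebra.Bundles using (CommutativeRing)
open import Level using (Level)
open import Data.Bool using (Bool; true; false; not; T)
open import Data.Fin using (toℕ)
open import Data.Integer as ℤ using (ℤ; +_; -[1+_])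
import Data.Integer.Properties as ℤₚ
open import Data.List using (List; []; _∷_; _++_; map; filter; upTo; applyUpTo; length; foldr)
import Data.List.Properties as Listₚ
open import Data.Nat as ℕ using (ℕ; zero; suc; NonZero; _≤_; _<_; z≤n; s≤s; _≟_)
import Data.Nat.Properties as ℕₚ
open import Data.Nat.Divisibility
open import Data.Nat.Primality
open import Data.Nat.GCD using (gcd)
open import Data.Product using (_×_; _,_; proj₂; ∃-syntax)
open import Data.Sum using (_⊎_; inj₁; inj₂; [_,_])
open import Function using (_∘_)
open import Function.Bundles using (_⇔_; mk⇔; Equivalence)
open import Relation.Nullary using (¬_; Dec; yes; no; does)
open import Relation.Nullary.Decidable using (_×-dec_)
open import Relation.Nullary.Negation using (contradiction)
open import Relation.Unary using (Pred; Decidable)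
open import Relation.Binary.PropositionalEquality as ≡ using (_≡_)

open Equivalence using (to; from)

-- Primes and the Möbius function.  ℕ's _+_ and _*_ are opened only inside this module, since they
-- would clash with the ring operations below.
module _ where

  open import Data.Bool.ListAction using (any)
  open import Data.Bool.Properties using (T-≡; ⇔→≡)
  open import Data.Empty using (⊥-elim)
  open import Data.List.Membership.Propositional using (lose; find)
  open import Data.List.Membership.Propositional.Properties using (∈-map⁺; ∈-map⁻; ∈-upTo⁺)
  open import Data.List.Relation.Unary.All using (_∷_)
  open import Data.List.Relation.Unary.Any.Properties using (any⁺; any⁻)
  open import Data.Nat using (_+_; _*_)
  open import Data.Nat.GCD using (gcd[m,n]∣m; gcd-greatest)
  open import Data.Nat.DivMod using (_/_; m*n/n≡m; m*[n/m]≡n)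
  open import Data.Nat.ListAction using (product)
  open import Data.Nat.Primality.Factorisation using (factorise)
  open import Relation.Binary.PropositionalEquality using (refl; sym; trans; cong; module ≡-Reasoning)

  ∃-prime-divisor : ∀ {k} → 2 ≤ k → ∃[ p ] Prime p × p ∣ k
  ∃-prime-divisor {k@(suc _)} 2≤k with factorise k
  ... | record { factors = [] ; isFactorisation = k≡1 } = contradiction (sym k≡1) (ℕₚ.<⇒≢ 2≤k)
  ... | record { factors = p ∷ ps ; isFactorisation = k≡p*ps ; factorsPrime = prime[p] ∷ _ } =
    p , prime[p] , divides (product ps) (trans k≡p*ps (ℕₚ.*-comm p (product ps)))

  prime⇒2≤ : ∀ {p} → Prime p → 2 ≤ p
  prime⇒2≤ {suc (suc _)} _ = s≤s (s≤s z≤n)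

  prime⇒1≤ : ∀ {p} → Prime p → 1 ≤ p
  prime⇒1≤ {suc _} _ = s≤s z≤n

  prime∣prime⇒≡ : ∀ {p q} → Prime p → Prime q → p ∣ q → p ≡ q
  prime∣prime⇒≡ prime[p] prime[q] p∣q with prime⇒irreducible prime[q] p∣q
  ... | inj₁ refl = contradiction prime[p] ¬prime[1]
  ... | inj₂ p≡q  = p≡q

  prime∣k∧j∣k⇒p*j∣k : ∀ {p j k} → Prime p → p ∣ k → ¬ p ∣ j → j ∣ k → p * j ∣ k
  prime∣k∧j∣k⇒p*j∣k {p} {j} prime[p] p∣k p∤j (divides q refl) with euclidsLemma q j prime[p] p∣k
  ... | inj₂ p∣j = contradiction p∣j p∤j
  ... | inj₁ (divides r refl) = divides r (ℕₚ.*-assoc r p j)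

  square∣p*j⇒square∣j : ∀ {p j k} → Prime p → ¬ p ∣ j → k * k ∣ p * j → k * k ∣ j
  square∣p*j⇒square∣j {p} {j} {k} prime[p] p∤j k²∣pj with p ∣? k
  ... | yes p∣k = contradiction
        (*-cancelˡ-∣ p {{prime⇒nonZero prime[p]}} (∣-trans (*-pres-∣ p∣k p∣k) k²∣pj)) p∤j
  ... | no p∤k with k²∣pj
  ...   | divides q pj≡qk² with euclidsLemma q (k * k) prime[p] (divides j (trans (sym pj≡qk²) (ℕₚ.*-comm p j)))
  ...     | inj₂ p∣k² = ⊥-elim ([ p∤k , p∤k ] (euclidsLemma k k prime[p] p∣k²))
  ...     | inj₁ (divides r refl) = *-cancelˡ-∣ p {{prime⇒nonZero prime[p]}} (divides r (trans pj≡qk² (ℕₚ.*-assoc r p (k * k))))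

  -- μ n unfolds to  if squareful n then + 0 else -[1+ 0 ] ℤ.^ ω n.
  squareful : ℕ → Bool
  squareful n = any (λ k → does (k * k ∣? n)) (map (λ i → suc (suc i)) (upTo n))

  countBelow : ∀ {ℓ} {P : Pred ℕ ℓ} → Decidable P → ℕ → ℕ
  countBelow P? N = length (filter P? (upTo N))

  ω : ℕ → ℕ
  ω n = countBelow (λ p → prime? p ×-dec p ∣? n) (suc n)

  T-does⇒ : ∀ {a} {A : Set a} (a? : Dec A) → T (does a?) → A
  T-does⇒ (yes a) _ = a

  ⇒T-does : ∀ {a} {A : Set a} (a? : Dec A) → A → T (does a?)
  ⇒T-does (yes _) _ = _
  ⇒T-does (no ¬a) a = ¬a a

  HasSquareDivisor : ℕ → Set
  HasSquareDivisor n = ∃[ k ] 2 ≤ k × k * k ∣ n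

  squareful⇔ : ∀ {n} → 1 ≤ n → squareful n ≡ true ⇔ HasSquareDivisor n
  squareful⇔ {n} 1≤n = mk⇔ (sound ∘ from T-≡) (to T-≡ ∘ complete)
    where
    sound : T (squareful n) → HasSquareDivisor n
    sound t with find (any⁻ _ (map (λ i → suc (suc i)) (upTo n)) t)
    ... | _ , k∈ , k²∣n with ∈-map⁻ _ k∈
    ...   | i , _ , refl = suc (suc i) , s≤s (s≤s z≤n) , T-does⇒ (suc (suc i) * suc (suc i) ∣? n) k²∣n
    complete : HasSquareDivisor n → T (squareful n)
    complete (suc zero , s≤s () , _)
    complete (suc (suc i) , _ , k²∣n) =
      any⁺ _ (lose (∈-map⁺ _ (∈-upTo⁺ i<n)) (⇒T-does (suc (suc i) * suc (suc i) ∣? n) k²∣n))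
      where
      i<n : i < n
      i<n = ℕₚ.≤-trans (ℕₚ.n≤1+n (suc i))
             (ℕₚ.≤-trans (ℕₚ.m≤m*n (suc (suc i)) (suc (suc i))) (∣⇒≤ {{ℕ.>-nonZero 1≤n}} k²∣n))

  squareful[p*j]≡squareful[j] : ∀ {p j} → Prime p → 1 ≤ j → ¬ p ∣ j → squareful (p * j) ≡ squareful j
  squareful[p*j]≡squareful[j] {p} {j} prime[p] 1≤j p∤j = ⇔→≡ (mk⇔
    (λ sq[pj] → from (squareful⇔ 1≤j) (descend (to (squareful⇔ 1≤pj) sq[pj])))
    (λ sq[j]  → from (squareful⇔ 1≤pj) (ascend (to (squareful⇔ 1≤j) sq[j]))))
    where
    1≤pj : 1 ≤ p * j
    1≤pj = ℕₚ.*-mono-≤ (prime⇒1≤ prime[p]) 1≤j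
    descend : HasSquareDivisor (p * j) → HasSquareDivisor j
    descend (k , 2≤k , k²∣pj) = k , 2≤k , square∣p*j⇒square∣j {k = k} prime[p] p∤j k²∣pj
    ascend : HasSquareDivisor j → HasSquareDivisor (p * j)
    ascend (k , 2≤k , k²∣j) = k , 2≤k , ∣n⇒∣m*n p k²∣j

  module _ {ℓ} {P : Pred ℕ ℓ} (P? : Decidable P) where

    countBelow-suc : ∀ N → countBelow P? (suc N) ≡ countBelow P? N + length (filter P? (N ∷ []))
    countBelow-suc N = begin
      length (filter P? (upTo (suc N)))                 ≡⟨ cong (length ∘ filter P?) (sym (Listₚ.upTo-∷ʳ N)) ⟩
      length (filter P? (upTo N ++ N ∷ []))             ≡⟨ cong length (Listₚ.filter-++ P? (upTo N) (N ∷ [])) ⟩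
      length (filter P? (upTo N) ++ filter P? (N ∷ [])) ≡⟨ Listₚ.length-++ (filter P? (upTo N)) ⟩
      countBelow P? N + length (filter P? (N ∷ []))     ∎
      where open ≡-Reasoning

    countBelow-accept : ∀ {N} → P N → countBelow P? (suc N) ≡ suc (countBelow P? N)
    countBelow-accept {N} pN = begin
      countBelow P? (suc N)                         ≡⟨ countBelow-suc N ⟩
      countBelow P? N + length (filter P? (N ∷ [])) ≡⟨ cong (λ xs → countBelow P? N + length xs) (Listₚ.filter-accept P? pN) ⟩
      countBelow P? N + 1                           ≡⟨ ℕₚ.+-comm (countBelow P? N) 1 ⟩
      suc (countBelow P? N)                         ∎
      where open ≡-Reasoning

    countBelow-reject : ∀ {N} → ¬ P N → countBelow P? (suc N) ≡ countBelow P? N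
    countBelow-reject {N} ¬pN = begin
      countBelow P? (suc N)                         ≡⟨ countBelow-suc N ⟩
      countBelow P? N + length (filter P? (N ∷ [])) ≡⟨ cong (λ xs → countBelow P? N + length xs) (Listₚ.filter-reject P? ¬pN) ⟩
      countBelow P? N + 0                           ≡⟨ ℕₚ.+-identityʳ (countBelow P? N) ⟩
      countBelow P? N                               ∎
      where open ≡-Reasoning

    countBelow-stable : ∀ {M N} → (∀ {i} → M ≤ i → ¬ P i) → M ≤ N → countBelow P? N ≡ countBelow P? M
    countBelow-stable {M} {N} none M≤N with ℕₚ.m≤n⇒m<n∨m≡n M≤N
    ... | inj₂ refl = refl
    countBelow-stable {M} {suc N} none _ | inj₁ (s≤s M≤N) =
      trans (countBelow-reject (none M≤N)) (countBelow-stable none M≤N)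

  module _ {ℓ₁ ℓ₂} {P : Pred ℕ ℓ₁} {Q : Pred ℕ ℓ₂} (P? : Decidable P) (Q? : Decidable Q) where

    countBelow-cong : ∀ {N} → (∀ {i} → i < N → P i ⇔ Q i) → countBelow P? N ≡ countBelow Q? N
    countBelow-cong {zero}  _ = refl
    countBelow-cong {suc N} P⇔Q with P? N
    ... | yes pN = trans (countBelow-accept P? pN)
                     (trans (cong suc (countBelow-cong (P⇔Q ∘ ℕₚ.m<n⇒m<1+n)))
                            (sym (countBelow-accept Q? (to (P⇔Q ℕₚ.≤-refl) pN))))
    ... | no ¬pN = trans (countBelow-reject P? ¬pN)
                     (trans (countBelow-cong (P⇔Q ∘ ℕₚ.m<n⇒m<1+n))
                            (sym (countBelow-reject Q? (¬pN ∘ from (P⇔Q ℕₚ.≤-refl)))))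

    countBelow-insert : ∀ {p N} → (∀ {i} → Q i ⇔ (P i ⊎ i ≡ p)) → ¬ P p → p < N →
                        countBelow Q? N ≡ suc (countBelow P? N)
    countBelow-insert {p} {suc N} Q⇔P+p ¬pp (s≤s p≤N) with ℕₚ.m≤n⇒m<n∨m≡n p≤N
    ... | inj₂ refl = trans (countBelow-accept Q? (from Q⇔P+p (inj₂ refl)))
                        (cong suc (trans (sym (countBelow-cong below))
                                         (sym (countBelow-reject P? ¬pp))))
      where
      below : ∀ {i} → i < p → P i ⇔ Q i
      below i<p = mk⇔ (from Q⇔P+p ∘ inj₁)
                      ([ (λ pi → pi) , (λ { refl → contradiction i<p (ℕₚ.<-irrefl refl) }) ] ∘ to Q⇔P+p)
    ... | inj₁ p<N with P? N
    ...   | yes pN = trans (countBelow-accept Q? (from Q⇔P+p (inj₁ pN)))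
                       (cong suc (trans (countBelow-insert Q⇔P+p ¬pp p<N) (sym (countBelow-accept P? pN))))
    ...   | no ¬pN = trans (countBelow-reject Q? (≢p ∘ to Q⇔P+p))
                       (trans (countBelow-insert Q⇔P+p ¬pp p<N) (cong suc (sym (countBelow-reject P? ¬pN))))
      where
      ≢p : ¬ (P N ⊎ N ≡ p)
      ≢p = [ ¬pN , (λ { refl → ℕₚ.<-irrefl refl p<N }) ]

  ω[p*j]≡1+ω[j] : ∀ {p j} → Prime p → 1 ≤ j → ¬ p ∣ j → ω (p * j) ≡ suc (ω j)
  ω[p*j]≡1+ω[j] {p} {j} prime[p] 1≤j p∤j = begin
    countBelow PrimeDivisor[pj]? (suc (p * j)) ≡⟨ countBelow-insert PrimeDivisor[j]? PrimeDivisor[pj]? split (p∤j ∘ proj₂) (s≤s p≤pj) ⟩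
    suc (countBelow PrimeDivisor[j]? (suc (p * j))) ≡⟨ cong suc (countBelow-stable PrimeDivisor[j]? beyond-j (s≤s j≤pj)) ⟩
    suc (ω j) ∎
    where
    open ≡-Reasoning
    PrimeDivisor[j]? = λ q → prime? q ×-dec q ∣? j
    PrimeDivisor[pj]? = λ q → prime? q ×-dec q ∣? p * j
    p≤pj : p ≤ p * j
    p≤pj = ℕₚ.m≤m*n p j {{ℕ.>-nonZero 1≤j}}
    j≤pj : j ≤ p * j
    j≤pj = ℕₚ.m≤n*m j p {{prime⇒nonZero prime[p]}}
    beyond-j : ∀ {i} → suc j ≤ i → ¬ (Prime i × i ∣ j)
    beyond-j j<i (_ , i∣j) = ℕₚ.<⇒≱ j<i (∣⇒≤ {{ℕ.>-nonZero 1≤j}} i∣j)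
    split : ∀ {q} → (Prime q × q ∣ p * j) ⇔ ((Prime q × q ∣ j) ⊎ q ≡ p)
    split {q} = mk⇔
      (λ (prime[q] , q∣pj) → [ (λ q∣p → inj₂ (prime∣prime⇒≡ prime[q] prime[p] q∣p)) , (λ q∣j → inj₁ (prime[q] , q∣j)) ]
                               (euclidsLemma p j prime[q] q∣pj))
      [ (λ (prime[q] , q∣j) → prime[q] , ∣n⇒∣m*n p q∣j) , (λ { refl → prime[p] , ∣m⇒∣m*n j ∣-refl }) ]

  μ[p*j]≡0 : ∀ {p j} → Prime p → 1 ≤ j → p ∣ j → μ (p * j) ≡ + 0
  μ[p*j]≡0 {p} {j} prime[p] 1≤j p∣j
    rewrite from (squareful⇔ (ℕₚ.*-mono-≤ (prime⇒1≤ prime[p]) 1≤j)) (p , prime⇒2≤ prime[p] , *-monoʳ-∣ p p∣j) = refl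

  μ[p*j]≡-μ[j] : ∀ {p j} → Prime p → 1 ≤ j → ¬ p ∣ j → μ (p * j) ≡ ℤ.- μ j
  μ[p*j]≡-μ[j] {p} {j} prime[p] 1≤j p∤j rewrite squareful[p*j]≡squareful[j] prime[p] 1≤j p∤j with squareful j
  ... | true  = refl
  ... | false rewrite ω[p*j]≡1+ω[j] prime[p] 1≤j p∤j = ℤₚ.-1*i≡-i _

  gcd[k,n]≡k : ∀ {k n} → k ∣ n → gcd k n ≡ k
  gcd[k,n]≡k {k} {n} k∣n = ∣-antisym (gcd[m,n]∣m k n) (gcd-greatest ∣-refl k∣n)

  m≤m*n⁺ : ∀ m {n} → 1 ≤ n → m ≤ m * n
  m≤m*n⁺ m 1≤n = ℕₚ.m≤m*n m _ {{ℕ.>-nonZero 1≤n}}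

  m≤n*m⁺ : ∀ m {n} → 1 ≤ n → m ≤ n * m
  m≤n*m⁺ m 1≤n = ℕₚ.m≤n*m m _ {{ℕ.>-nonZero 1≤n}}

  1≤m*n⇒1≤n : ∀ m {n} → 1 ≤ m * n → 1 ≤ n
  1≤m*n⇒1≤n m {n} 1≤mn = ℕ.>-nonZero⁻¹ n {{ℕₚ.m*n≢0⇒n≢0 m {{ℕ.>-nonZero 1≤mn}}}}

  quot-* : ∀ {a b n} → 1 ≤ a → a * b ≡ n → quot n a ≡ b
  quot-* {suc a} {b} _ refl = trans (cong (_/ suc a) (ℕₚ.*-comm (suc a) b)) (m*n/n≡m b (suc a))

  *-quot : ∀ {a n} → 1 ≤ a → a ∣ n → a * quot n a ≡ n
  *-quot {suc a} _ a∣n = m*[n/m]≡n a∣n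

module _ {c ℓ} (R : CommutativeRing c ℓ) where

  open CommutativeRing R
  open import Relation.Binary.Reasoning.Setoid setoid
  open import Algebra.Properties.Ring ring using (-0#≈0#; -‿+-comm; -‿involutive; -1*x≈-x)
  open import Algebra.Properties.Monoid.Mult +-monoid using (×-homo-+)
  open import Algebra.Properties.Monoid.Sum +-monoid using (sum-syntax)
  open import Algebra.Properties.CommutativeMonoid.Sum +-commutativeMonoid using (∑-distrib-+; ∑-comm)
  open import Algebra.Properties.Semiring.Sum semiring using (*-distribˡ-sum)
  open import Algebra.Properties.CommutativeSemigroup +-commutativeSemigroup using (interchange)
  open import Algebra.Properties.CommutativeSemigroup *-commutativeSemigroup using (xy∙z≈xz∙y) renaming (interchange to interchange*)
  open import Algebra.Properties.Semiring.Mult semiring using (×1-homo-*)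

  fromℤ-⊖ : ∀ m n → fromℤ R (m ℤ.⊖ n) ≈ fromℕ R m - fromℕ R n
  fromℤ-⊖ m       zero    = sym (trans (+-congˡ -0#≈0#) (+-identityʳ _))
  fromℤ-⊖ zero    (suc n) = sym (+-identityˡ _)
  fromℤ-⊖ (suc m) (suc n) = begin
    fromℤ R (suc m ℤ.⊖ suc n)               ≡⟨ ≡.cong (fromℤ R) (ℤₚ.[1+m]⊖[1+n]≡m⊖n m n) ⟩
    fromℤ R (m ℤ.⊖ n)                       ≈⟨ fromℤ-⊖ m n ⟩
    fromℕ R m - fromℕ R n                   ≈⟨ +-identityˡ _ ⟨
    0# + (fromℕ R m - fromℕ R n)            ≈⟨ +-congʳ (-‿inverseʳ 1#) ⟨
    (1# - 1#) + (fromℕ R m - fromℕ R n)     ≈⟨ interchange 1# (- 1#) (fromℕ R m) (- fromℕ R n) ⟩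
    fromℕ R (suc m) + (- 1# - fromℕ R n)    ≈⟨ +-congˡ (-‿+-comm 1# (fromℕ R n)) ⟩
    fromℕ R (suc m) - fromℕ R (suc n)       ∎

  fromℤ-+ : ∀ i j → fromℤ R (i ℤ.+ j) ≈ fromℤ R i + fromℤ R j
  fromℤ-+ (+ m)    (+ n)    = ×-homo-+ 1# m n
  fromℤ-+ (+ m)    -[1+ n ] = fromℤ-⊖ m (suc n)
  fromℤ-+ -[1+ m ] (+ n)    = trans (fromℤ-⊖ n (suc m)) (+-comm _ _)
  fromℤ-+ -[1+ m ] -[1+ n ] = begin
    - fromℕ R (suc (suc (m ℕ.+ n)))         ≡⟨ ≡.cong (λ k → - fromℕ R k) (ℕₚ.+-suc (suc m) n) ⟨
    - fromℕ R (suc m ℕ.+ suc n)             ≈⟨ -‿cong (×-homo-+ 1# (suc m) (suc n)) ⟩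
    - (fromℕ R (suc m) + fromℕ R (suc n))   ≈⟨ -‿+-comm _ _ ⟨
    - fromℕ R (suc m) - fromℕ R (suc n)     ∎

  fromℤ-neg : ∀ i → fromℤ R (ℤ.- i) ≈ - fromℤ R i
  fromℤ-neg (+ zero)  = sym -0#≈0#
  fromℤ-neg (+ suc n) = refl
  fromℤ-neg -[1+ n ]  = sym (-‿involutive _)

  fromℤ-ℕ* : ∀ d i → fromℤ R (+ d ℤ.* i) ≈ fromℕ R d * fromℤ R i
  fromℤ-ℕ* zero    i = begin
    fromℤ R (+ 0 ℤ.* i)                     ≡⟨ ≡.cong (fromℤ R) (ℤₚ.*-zeroˡ i) ⟩
    0#                                      ≈⟨ zeroˡ _ ⟨
    0# * fromℤ R i                          ∎
  fromℤ-ℕ* (suc d) i = begin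
    fromℤ R (+ suc d ℤ.* i)                 ≡⟨ ≡.cong (fromℤ R) (ℤₚ.suc-* (+ d) i) ⟩
    fromℤ R (i ℤ.+ + d ℤ.* i)               ≈⟨ fromℤ-+ i (+ d ℤ.* i) ⟩
    fromℤ R i + fromℤ R (+ d ℤ.* i)         ≈⟨ +-cong (sym (*-identityˡ _)) (fromℤ-ℕ* d i) ⟩
    1# * fromℤ R i + fromℕ R d * fromℤ R i  ≈⟨ distribʳ _ _ _ ⟨
    fromℕ R (suc d) * fromℤ R i             ∎

  -- Finite sums over 1 … n, with Iverson brackets.

  when : Bool → Carrier → Carrier
  when true  x = x
  when false _ = 0#

  module _ {a} {A : Set a} {x : Carrier} where

    when-no : (a? : Dec A) → ¬ A → when (does a?) x ≈ 0#
    when-no (yes a) ¬a = contradiction a ¬a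
    when-no (no _)  _  = refl

    when-cong : ∀ {y} (a? : Dec A) → (A → x ≈ y) → when (does a?) x ≈ when (does a?) y
    when-cong (yes a) x≈y = x≈y a
    when-cong (no _)  _   = refl

    when-⇔ : ∀ {b} {B : Set b} (a? : Dec A) (b? : Dec B) → (A → B) → (B → A) → when (does a?) x ≈ when (does b?) x
    when-⇔ (yes _) (yes _) _   _   = refl
    when-⇔ (yes a) (no ¬b) A→B _   = contradiction (A→B a) ¬b
    when-⇔ (no ¬a) (yes b) _   B→A = contradiction (B→A b) ¬a
    when-⇔ (no _)  (no _)  _   _   = refl

  when-0# : ∀ b → when b 0# ≈ 0#
  when-0# true  = refl
  when-0# false = refl

  when-*ˡ : ∀ b x y → x * when b y ≈ when b (x * y)
  when-*ˡ true  x y = refl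
  when-*ˡ false x y = zeroʳ x

  when-*ʳ : ∀ b x y → when b x * y ≈ when b (x * y)
  when-*ʳ true  x y = refl
  when-*ʳ false x y = zeroˡ y

  when-neg : ∀ b x → when b (- x) ≈ - when b x
  when-neg true  x = refl
  when-neg false x = sym -0#≈0#

  when-split : ∀ b x → x ≈ when b x + when (not b) x
  when-split true  x = sym (+-identityʳ x)
  when-split false x = sym (+-identityˡ x)

  when-comm : ∀ b c x → when b (when c x) ≈ when c (when b x)
  when-comm true  c     x = refl
  when-comm false true  x = refl
  when-comm false false x = refl

  listSum : List ℕ → (ℕ → Carrier) → Carrier
  listSum xs f = foldr (λ k acc → f k + acc) 0# xs

  listSum-cong : ∀ xs {f g} → (∀ k → f k ≈ g k) → listSum xs f ≈ listSum xs g
  listSum-cong []       f≈g = refl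
  listSum-cong (x ∷ xs) f≈g = +-cong (f≈g x) (listSum-cong xs f≈g)

  *-distribˡ-listSum : ∀ xs x f → x * listSum xs f ≈ listSum xs (λ k → x * f k)
  *-distribˡ-listSum []       x f = zeroʳ x
  *-distribˡ-listSum (y ∷ ys) x f = trans (distribˡ x _ _) (+-congˡ (*-distribˡ-listSum ys x f))

  fromℤ-listSum : ∀ xs (f : ℕ → ℤ) → fromℤ R (foldr (λ k acc → f k ℤ.+ acc) (+ 0) xs) ≈ listSum xs (fromℤ R ∘ f)
  fromℤ-listSum []       f = refl
  fromℤ-listSum (x ∷ xs) f = trans (fromℤ-+ (f x) _) (+-congˡ (fromℤ-listSum xs f))

  listSum-filter : ∀ {p} {P : Pred ℕ p} (P? : Decidable P) xs f →
                   listSum (filter P? xs) f ≈ listSum xs (λ k → when (does (P? k)) (f k))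
  listSum-filter P? []       f = refl
  listSum-filter P? (x ∷ xs) f with does (P? x)
  ... | true  = +-congˡ (listSum-filter P? xs f)
  ... | false = trans (listSum-filter P? xs f) (sym (+-identityˡ _))

  listSum-applyUpTo : ∀ g n f → listSum (applyUpTo g n) f ≈ ∑[ i < n ] f (g (toℕ i))
  listSum-applyUpTo g zero    f = refl
  listSum-applyUpTo g (suc n) f = +-congˡ (listSum-applyUpTo (g ∘ suc) n f)

  -- Opaque, so that unification sees sumTo n f rather than a fold over Fin n and can infer summands.
  opaque

    sumTo : ℕ → (ℕ → Carrier) → Carrier
    sumTo n f = ∑[ i < n ] f (suc (toℕ i))

    sumTo-cong : ∀ n {f g} → (∀ {k} → 1 ≤ k → k ≤ n → f k ≈ g k) → sumTo n f ≈ sumTo n g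
    sumTo-cong zero    f≈g = refl
    sumTo-cong (suc n) f≈g = +-cong (f≈g ℕₚ.≤-refl (s≤s z≤n)) (sumTo-cong n (λ _ k≤n → f≈g (s≤s z≤n) (s≤s k≤n)))

    sumTo-zero : ∀ n f → (∀ {k} → 1 ≤ k → k ≤ n → f k ≈ 0#) → sumTo n f ≈ 0#
    sumTo-zero zero    f f≈0 = refl
    sumTo-zero (suc n) f f≈0 = trans (+-cong (f≈0 ℕₚ.≤-refl (s≤s z≤n)) (sumTo-zero n (f ∘ suc) (λ _ k≤n → f≈0 (s≤s z≤n) (s≤s k≤n))))
                                   (+-identityˡ 0#)

    sumTo-+ : ∀ n f g → sumTo n (λ k → f k + g k) ≈ sumTo n f + sumTo n g
    sumTo-+ n f g = ∑-distrib-+ {n} (f ∘ suc ∘ toℕ) (g ∘ suc ∘ toℕ)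

    *-distribˡ-sumTo : ∀ n x f → x * sumTo n f ≈ sumTo n (λ k → x * f k)
    *-distribˡ-sumTo n x f = *-distribˡ-sum {n} x (f ∘ suc ∘ toℕ)

    sumTo-comm : ∀ m n (f : ℕ → ℕ → Carrier) → sumTo m (λ a → sumTo n (f a)) ≈ sumTo n (λ b → sumTo m (λ a → f a b))
    sumTo-comm m n f = ∑-comm {m} {n} (λ i j → f (suc (toℕ i)) (suc (toℕ j)))

    sumTo-extend : ∀ {m n} f → m ≤ n → (∀ {k} → m < k → k ≤ n → f k ≈ 0#) → sumTo m f ≈ sumTo n f
    sumTo-extend {zero}  {n}     f _         rest≈0 = sym (sumTo-zero n f rest≈0)
    sumTo-extend {suc m} {suc n} f (s≤s m≤n) rest≈0 =
      +-congˡ (sumTo-extend (f ∘ suc) m≤n (λ m<k k≤n → rest≈0 (s≤s m<k) (s≤s k≤n)))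

    sumTo-delta : ∀ n {t} (h : ℕ → Carrier) → 1 ≤ t → (n < t → h t ≈ 0#) → sumTo n (λ k → when (does (k ≟ t)) (h k)) ≈ h t
    sumTo-delta zero h (s≤s _) beyond = sym (beyond (s≤s z≤n))
    sumTo-delta (suc n) {suc zero} h _ _ = trans (+-congˡ (sumTo-zero n (λ k → when (does (suc k ≟ 1)) (h (suc k))) (λ { (s≤s _) _ → refl })))
                                                 (+-identityʳ (h 1))
    -- does (suc k ≟ suc t) reduces to does (k ≟ t).
    sumTo-delta (suc n) {suc (suc t)} h _ beyond =
      trans (+-identityˡ _) (sumTo-delta n {suc t} (λ k → h (suc k)) (s≤s z≤n) (λ n<t → beyond (s≤s n<t)))

    listSum-upTo : ∀ n f → listSum (map suc (upTo n)) f ≈ sumTo n f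
    listSum-upTo n f = trans (reflexive (≡.cong (λ ks → listSum ks f) (Listₚ.map-applyUpTo (λ k → k) suc n)))
                             (listSum-applyUpTo suc n f)

  *-distribʳ-sumTo : ∀ n x f → sumTo n f * x ≈ sumTo n (λ k → f k * x)
  *-distribʳ-sumTo n x f = trans (*-comm _ x) (trans (*-distribˡ-sumTo n x f) (sumTo-cong n (λ {k} _ _ → *-comm x (f k))))

  sumTo-neg : ∀ n f → sumTo n (λ k → - f k) ≈ - sumTo n f
  sumTo-neg n f = begin
    sumTo n (λ k → - f k)      ≈⟨ sumTo-cong n (λ {k} _ _ → -1*x≈-x (f k)) ⟨
    sumTo n (λ k → - 1# * f k) ≈⟨ *-distribˡ-sumTo n (- 1#) f ⟨
    - 1# * sumTo n f           ≈⟨ -1*x≈-x _ ⟩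
    - sumTo n f                ∎

  when-sumTo : ∀ b n f → when b (sumTo n f) ≈ sumTo n (λ k → when b (f k))
  when-sumTo true  n f = refl
  when-sumTo false n f = sym (sumTo-zero n _ (λ _ _ → refl))

  sumTo-sink₂ : ∀ n (F : ℕ → ℕ → ℕ → Carrier) →
    sumTo n (λ d → sumTo n (λ a → sumTo n (λ b → F d a b))) ≈ sumTo n (λ a → sumTo n (λ b → sumTo n (λ d → F d a b)))
  sumTo-sink₂ n F = trans (sumTo-comm n n _) (sumTo-cong n (λ _ _ → sumTo-comm n n _))

  sumTo-sink₃ : ∀ n (F : ℕ → ℕ → ℕ → ℕ → Carrier) →
    sumTo n (λ d → sumTo n (λ a → sumTo n (λ b → sumTo n (λ c → F d a b c)))) ≈
    sumTo n (λ a → sumTo n (λ b → sumTo n (λ c → sumTo n (λ d → F d a b c))))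
  sumTo-sink₃ n F = trans (sumTo-comm n n _) (sumTo-cong n (λ _ _ → sumTo-sink₂ n _))

  sumTo-collapse : ∀ n {t} (φ : ℕ → ℕ) x → 1 ≤ t → t ≤ φ t →
    sumTo n (λ d → when (does (φ d ≟ n)) (when (does (t ≟ d)) x)) ≈ when (does (φ t ≟ n)) x
  sumTo-collapse n {t} φ x 1≤t t≤φt = begin
    sumTo n (λ d → when (does (φ d ≟ n)) (when (does (t ≟ d)) x))
      ≈⟨ sumTo-cong n (λ {d} _ _ → trans (when-comm (does (φ d ≟ n)) (does (t ≟ d)) x)
                                         (when-⇔ (t ≟ d) (d ≟ t) ≡.sym ≡.sym)) ⟩
    sumTo n (λ d → when (does (d ≟ t)) (when (does (φ d ≟ n)) x))
      ≈⟨ sumTo-delta n (λ d → when (does (φ d ≟ n)) x) 1≤t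
           (λ n<t → when-no (φ t ≟ n) (λ φt≡n → ℕₚ.<⇒≱ n<t (≡.subst (t ≤_) φt≡n t≤φt))) ⟩
    when (does (φ t ≟ n)) x ∎

  sumTo-multiples : ∀ n {p} (H : ℕ → Carrier) → 1 ≤ p → (∀ {t} → n < t → H t ≈ 0#) →
                    sumTo n (λ d → when (does (p ∣? d)) (H d)) ≈ sumTo n (λ j → H (p ℕ.* j))
  sumTo-multiples n {p} H 1≤p beyond = begin
    sumTo n (λ d → when (does (p ∣? d)) (H d))                          ≈⟨ sumTo-cong n multiple-term ⟩
    sumTo n (λ d → sumTo n (λ j → when (does (d ≟ p ℕ.* j)) (H d)))     ≈⟨ sumTo-comm n n _ ⟩
    sumTo n (λ j → sumTo n (λ d → when (does (d ≟ p ℕ.* j)) (H d)))     ≈⟨ sumTo-cong n (λ {j} 1≤j _ →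
                                                                             sumTo-delta n H (ℕₚ.*-mono-≤ 1≤p 1≤j) beyond) ⟩
    sumTo n (λ j → H (p ℕ.* j))                                         ∎
    where
    multiple-term : ∀ {d} → 1 ≤ d → d ≤ n →
                    when (does (p ∣? d)) (H d) ≈ sumTo n (λ j → when (does (d ≟ p ℕ.* j)) (H d))
    multiple-term {d} 1≤d d≤n with p ∣? d
    ... | no p∤d = sym (sumTo-zero n _ (λ {j} _ _ → when-no (d ≟ p ℕ.* j) (λ d≡pj → p∤d (divides j (≡.trans d≡pj (ℕₚ.*-comm p j))))))
    ... | yes p∣d = sym (begin
      sumTo n (λ j → when (does (d ≟ p ℕ.* j)) (H d))   ≈⟨ sumTo-cong n (λ {j} _ _ → when-⇔ (d ≟ p ℕ.* j) (j ≟ quot d p)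
                                                             (λ d≡pj → ≡.sym (quot-* 1≤p (≡.sym d≡pj))) (λ { ≡.refl → ≡.sym (*-quot 1≤p p∣d) })) ⟩
      sumTo n (λ j → when (does (j ≟ quot d p)) (H d))  ≈⟨ sumTo-delta n (λ _ → H d) 1≤d/p (λ n<d/p → contradiction (ℕₚ.≤-trans d/p≤d d≤n) (ℕₚ.<⇒≱ n<d/p)) ⟩
      H d                                               ∎)
      where
      1≤d/p : 1 ≤ quot d p
      1≤d/p = 1≤m*n⇒1≤n p (≡.subst (1 ≤_) (≡.sym (*-quot 1≤p p∣d)) 1≤d)
      d/p≤d : quot d p ≤ d
      d/p≤d = ≡.subst (quot d p ≤_) (*-quot 1≤p p∣d) (m≤n*m⁺ (quot d p) 1≤p)

  sumDiv≈sumTo : ∀ n f → sumDiv R n f ≈ sumTo n (λ k → when (does (k ∣? n)) (f k))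
  sumDiv≈sumTo n f = trans (listSum-filter (_∣? n) (map suc (upTo n)) f) (listSum-upTo n _)

  -- Dirichlet convolution.

  infixl 7 _⋆_

  _⋆_ : (ℕ → Carrier) → (ℕ → Carrier) → ℕ → Carrier
  (f ⋆ g) n = sumTo n (λ a → sumTo n (λ b → when (does (a ℕ.* b ≟ n)) (f a * g b)))

  sumDiv-⋆ : ∀ n f g → sumDiv R n (λ d → f d * g (quot n d)) ≈ (f ⋆ g) n
  sumDiv-⋆ n f g = trans (sumDiv≈sumTo n _) (sumTo-cong n divisor-term)
    where
    divisor-term : ∀ {a} → 1 ≤ a → a ≤ n →
                   when (does (a ∣? n)) (f a * g (quot n a)) ≈ sumTo n (λ b → when (does (a ℕ.* b ≟ n)) (f a * g b))
    divisor-term {a} 1≤a a≤n with a ∣? n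
    ... | no a∤n = sym (sumTo-zero n _ (λ {b} _ _ → when-no {x = f a * g b} (a ℕ.* b ≟ n) (λ ab≡n → a∤n (divides b (≡.trans (≡.sym ab≡n) (ℕₚ.*-comm a b))))))
    ... | yes a∣n = sym (begin
      sumTo n (λ b → when (does (a ℕ.* b ≟ n)) (f a * g b))   ≈⟨ sumTo-cong n (λ {b} _ _ → when-⇔ {x = f a * g b} (a ℕ.* b ≟ n) (b ≟ quot n a)
                                                                      (λ ab≡n → ≡.sym (quot-* 1≤a ab≡n)) (λ { ≡.refl → *-quot 1≤a a∣n })) ⟩
      sumTo n (λ b → when (does (b ≟ quot n a)) (f a * g b))  ≈⟨ sumTo-delta n (λ b → f a * g b) 1≤n/a (λ n<n/a → contradiction n/a≤n (ℕₚ.<⇒≱ n<n/a)) ⟩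
      f a * g (quot n a)                                      ∎)
      where
      1≤n/a : 1 ≤ quot n a
      1≤n/a = 1≤m*n⇒1≤n a (≡.subst (1 ≤_) (≡.sym (*-quot 1≤a a∣n)) (ℕₚ.≤-trans 1≤a a≤n))
      n/a≤n : quot n a ≤ n
      n/a≤n = ≡.subst (quot n a ≤_) (*-quot 1≤a a∣n) (m≤n*m⁺ (quot n a) 1≤a)

  ⋆-cong : ∀ n {f g f′ g′} → (∀ {a b} → a ℕ.* b ≡ n → f a * g b ≈ f′ a * g′ b) → (f ⋆ g) n ≈ (f′ ⋆ g′) n
  ⋆-cong n fg≈f′g′ = sumTo-cong n (λ {a} _ _ → sumTo-cong n (λ {b} _ _ → when-cong (a ℕ.* b ≟ n) fg≈f′g′))

  ⋆-comm : ∀ n f g → (f ⋆ g) n ≈ (g ⋆ f) n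
  ⋆-comm n f g = trans (sumTo-comm n n _) (sumTo-cong n (λ {b} _ _ → sumTo-cong n (λ {a} _ _ →
    trans (when-⇔ (a ℕ.* b ≟ n) (b ℕ.* a ≟ n) (≡.trans (ℕₚ.*-comm b a)) (≡.trans (ℕₚ.*-comm a b)))
          (when-cong (b ℕ.* a ≟ n) (λ _ → *-comm (f a) (g b))))))

  ⋆-widen : ∀ {n N} f g → n ≤ N →
            (f ⋆ g) n ≈ sumTo N (λ a → sumTo N (λ b → when (does (a ℕ.* b ≟ n)) (f a * g b)))
  ⋆-widen {n} {N} f g n≤N =
    trans (sumTo-cong n (λ {a} 1≤a _ → sumTo-extend _ n≤N (λ {b} n<b _ →
             when-no (a ℕ.* b ≟ n) (λ ab≡n → ℕₚ.<⇒≱ n<b (≡.subst (b ≤_) ab≡n (m≤n*m⁺ b 1≤a))))))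
          (sumTo-extend _ n≤N (λ {a} n<a _ → sumTo-zero N _ (λ {b} 1≤b _ →
             when-no (a ℕ.* b ≟ n) (λ ab≡n → ℕₚ.<⇒≱ n<a (≡.subst (a ≤_) ab≡n (m≤m*n⁺ a 1≤b))))))

  ⋆₃ : (ℕ → Carrier) → (ℕ → Carrier) → (ℕ → Carrier) → ℕ → Carrier
  ⋆₃ f g h n = sumTo n (λ a → sumTo n (λ b → sumTo n (λ c → when (does (a ℕ.* b ℕ.* c ≟ n)) (f a * g b * h c))))

  ⋆-assocˡ : ∀ n f g h → ((f ⋆ g) ⋆ h) n ≈ ⋆₃ f g h n
  ⋆-assocˡ n f g h = begin
    ((f ⋆ g) ⋆ h) n
      ≈⟨ sumTo-cong n (λ {d} _ d≤n → sumTo-cong n (λ {c} _ _ → when-cong (d ℕ.* c ≟ n) (λ _ → expand d c d≤n))) ⟩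
    sumTo n (λ d → sumTo n (λ c → when (does (d ℕ.* c ≟ n))
      (sumTo n (λ a → sumTo n (λ b → when (does (a ℕ.* b ≟ d)) (f a * g b * h c))))))
      ≈⟨ sumTo-cong n (λ {d} _ _ → sumTo-cong n (λ {c} _ _ →
           trans (when-sumTo (does (d ℕ.* c ≟ n)) n _) (sumTo-cong n (λ _ _ → when-sumTo (does (d ℕ.* c ≟ n)) n _)))) ⟩
    sumTo n (λ d → sumTo n (λ c → sumTo n (λ a → sumTo n (λ b →
      when (does (d ℕ.* c ≟ n)) (when (does (a ℕ.* b ≟ d)) (f a * g b * h c))))))
      ≈⟨ sumTo-cong n (λ _ _ → sumTo-sink₂ n _) ⟩
    sumTo n (λ d → sumTo n (λ a → sumTo n (λ b → sumTo n (λ c →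
      when (does (d ℕ.* c ≟ n)) (when (does (a ℕ.* b ≟ d)) (f a * g b * h c))))))
      ≈⟨ sumTo-sink₃ n _ ⟩
    sumTo n (λ a → sumTo n (λ b → sumTo n (λ c → sumTo n (λ d →
      when (does (d ℕ.* c ≟ n)) (when (does (a ℕ.* b ≟ d)) (f a * g b * h c))))))
      ≈⟨ sumTo-cong n (λ {a} 1≤a _ → sumTo-cong n (λ {b} 1≤b _ → sumTo-cong n (λ {c} 1≤c _ →
           sumTo-collapse n (ℕ._* c) _ (ℕₚ.*-mono-≤ 1≤a 1≤b) (m≤m*n⁺ (a ℕ.* b) 1≤c)))) ⟩
    ⋆₃ f g h n ∎
    where
    expand : ∀ d c → d ≤ n → (f ⋆ g) d * h c ≈ sumTo n (λ a → sumTo n (λ b → when (does (a ℕ.* b ≟ d)) (f a * g b * h c)))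
    expand d c d≤n = trans (*-congʳ (⋆-widen f g d≤n))
      (trans (*-distribʳ-sumTo n (h c) _) (sumTo-cong n (λ {a} _ _ →
        trans (*-distribʳ-sumTo n (h c) _) (sumTo-cong n (λ {b} _ _ → when-*ʳ (does (a ℕ.* b ≟ d)) _ _)))))

  ⋆-assocʳ : ∀ n f g h → (f ⋆ (g ⋆ h)) n ≈ ⋆₃ f g h n
  ⋆-assocʳ n f g h = begin
    (f ⋆ (g ⋆ h)) n
      ≈⟨ sumTo-cong n (λ {a} _ _ → sumTo-cong n (λ {e} _ e≤n → when-cong (a ℕ.* e ≟ n) (λ _ → expand a e e≤n))) ⟩
    sumTo n (λ a → sumTo n (λ e → when (does (a ℕ.* e ≟ n))
      (sumTo n (λ b → sumTo n (λ c → when (does (b ℕ.* c ≟ e)) (f a * g b * h c))))))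
      ≈⟨ sumTo-cong n (λ {a} _ _ → sumTo-cong n (λ {e} _ _ →
           trans (when-sumTo (does (a ℕ.* e ≟ n)) n _) (sumTo-cong n (λ _ _ → when-sumTo (does (a ℕ.* e ≟ n)) n _)))) ⟩
    sumTo n (λ a → sumTo n (λ e → sumTo n (λ b → sumTo n (λ c →
      when (does (a ℕ.* e ≟ n)) (when (does (b ℕ.* c ≟ e)) (f a * g b * h c))))))
      ≈⟨ sumTo-cong n (λ _ _ → sumTo-sink₂ n _) ⟩
    sumTo n (λ a → sumTo n (λ b → sumTo n (λ c → sumTo n (λ e →
      when (does (a ℕ.* e ≟ n)) (when (does (b ℕ.* c ≟ e)) (f a * g b * h c))))))
      ≈⟨ sumTo-cong n (λ {a} 1≤a _ → sumTo-cong n (λ {b} 1≤b _ → sumTo-cong n (λ {c} 1≤c _ →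
           trans (sumTo-collapse n (a ℕ.*_) _ (ℕₚ.*-mono-≤ 1≤b 1≤c) (m≤n*m⁺ (b ℕ.* c) 1≤a))
                 (when-⇔ (a ℕ.* (b ℕ.* c) ≟ n) (a ℕ.* b ℕ.* c ≟ n)
                    (≡.trans (ℕₚ.*-assoc a b c)) (≡.trans (≡.sym (ℕₚ.*-assoc a b c))))))) ⟩
    ⋆₃ f g h n ∎
    where
    expand : ∀ a e → e ≤ n → f a * (g ⋆ h) e ≈ sumTo n (λ b → sumTo n (λ c → when (does (b ℕ.* c ≟ e)) (f a * g b * h c)))
    expand a e e≤n = trans (*-congˡ (⋆-widen g h e≤n))
      (trans (*-distribˡ-sumTo n (f a) _) (sumTo-cong n (λ {b} _ _ →
        trans (*-distribˡ-sumTo n (f a) _) (sumTo-cong n (λ {c} _ _ →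
          trans (when-*ˡ (does (b ℕ.* c ≟ e)) _ _) (when-cong (b ℕ.* c ≟ e) (λ _ → sym (*-assoc _ _ _))))))))

  ⋆-assoc : ∀ n f g h → ((f ⋆ g) ⋆ h) n ≈ (f ⋆ (g ⋆ h)) n
  ⋆-assoc n f g h = trans (⋆-assocˡ n f g h) (sym (⋆-assocʳ n f g h))

  δ : ℕ → Carrier
  δ k = when (does (k ≟ 1)) 1#

  ⋆-identityʳ : ∀ {n} f → 1 ≤ n → (f ⋆ δ) n ≈ f n
  ⋆-identityʳ {n} f 1≤n = begin
    (f ⋆ δ) n
      ≈⟨ sumTo-cong n (λ {a} _ _ → sumTo-cong n (λ {b} _ _ → selectᵇ a b)) ⟩
    sumTo n (λ a → sumTo n (λ b → when (does (b ≟ 1)) (when (does (a ≟ n)) (f a))))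
      ≈⟨ sumTo-cong n (λ {a} _ _ → sumTo-delta n (λ _ → when (does (a ≟ n)) (f a)) ℕₚ.≤-refl
                                     (λ n<1 → contradiction 1≤n (ℕₚ.<⇒≱ n<1))) ⟩
    sumTo n (λ a → when (does (a ≟ n)) (f a))
      ≈⟨ sumTo-delta n f 1≤n (λ n<n → contradiction n<n (ℕₚ.<-irrefl ≡.refl)) ⟩
    f n ∎
    where
    selectᵇ : ∀ a b → when (does (a ℕ.* b ≟ n)) (f a * δ b) ≈ when (does (b ≟ 1)) (when (does (a ≟ n)) (f a))
    selectᵇ a b = begin
      when (does (a ℕ.* b ≟ n)) (f a * δ b)
        ≈⟨ when-cong (a ℕ.* b ≟ n) (λ _ → trans (when-*ˡ (does (b ≟ 1)) (f a) 1#) (when-cong (b ≟ 1) (λ _ → *-identityʳ (f a)))) ⟩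
      when (does (a ℕ.* b ≟ n)) (when (does (b ≟ 1)) (f a))
        ≈⟨ when-comm (does (a ℕ.* b ≟ n)) (does (b ≟ 1)) (f a) ⟩
      when (does (b ≟ 1)) (when (does (a ℕ.* b ≟ n)) (f a))
        ≈⟨ when-cong (b ≟ 1) (λ { ≡.refl → when-⇔ (a ℕ.* 1 ≟ n) (a ≟ n)
                                   (≡.trans (≡.sym (ℕₚ.*-identityʳ a))) (≡.trans (ℕₚ.*-identityʳ a)) }) ⟩
      when (does (b ≟ 1)) (when (does (a ≟ n)) (f a)) ∎

  ⋆-identityˡ : ∀ {n} f → 1 ≤ n → (δ ⋆ f) n ≈ f n
  ⋆-identityˡ {n} f 1≤n = trans (⋆-comm n δ f) (⋆-identityʳ f 1≤n)

  𝟙 : ℕ → Carrier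
  𝟙 _ = 1#

  sumDiv≈⋆𝟙 : ∀ n F → sumDiv R n F ≈ (F ⋆ 𝟙) n
  sumDiv≈⋆𝟙 n F = trans (listSum-cong (divisors n) (λ d → sym (*-identityʳ (F d)))) (sumDiv-⋆ n F 𝟙)

  -- μ ⋆ 𝟙 = δ and Möbius inversion.

  μ[p*j]-term : ∀ {k p j} → Prime p → p ∣ k → 1 ≤ j →
                when (does (p ℕ.* j ∣? k)) (fromℤ R (μ (p ℕ.* j))) ≈
                - when (not (does (p ∣? j))) (when (does (j ∣? k)) (fromℤ R (μ j)))
  μ[p*j]-term {k} {p} {j} prime[p] p∣k 1≤j with p ∣? j
  ... | yes p∣j = begin
    when (does (p ℕ.* j ∣? k)) (fromℤ R (μ (p ℕ.* j))) ≡⟨ ≡.cong (when (does (p ℕ.* j ∣? k)) ∘ fromℤ R) (μ[p*j]≡0 prime[p] 1≤j p∣j) ⟩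
    when (does (p ℕ.* j ∣? k)) 0#                       ≈⟨ when-0# (does (p ℕ.* j ∣? k)) ⟩
    0#                                                  ≈⟨ -0#≈0# ⟨
    - 0#                                                ∎
  ... | no p∤j = begin
    when (does (p ℕ.* j ∣? k)) (fromℤ R (μ (p ℕ.* j)))  ≈⟨ when-cong (p ℕ.* j ∣? k) (λ _ →
                                                            trans (reflexive (≡.cong (fromℤ R) (μ[p*j]≡-μ[j] prime[p] 1≤j p∤j))) (fromℤ-neg (μ j))) ⟩
    when (does (p ℕ.* j ∣? k)) (- fromℤ R (μ j))        ≈⟨ when-⇔ (p ℕ.* j ∣? k) (j ∣? k) (m*n∣⇒n∣ p j) (prime∣k∧j∣k⇒p*j∣k prime[p] p∣k p∤j) ⟩
    when (does (j ∣? k)) (- fromℤ R (μ j))              ≈⟨ when-neg (does (j ∣? k)) _ ⟩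
    - when (does (j ∣? k)) (fromℤ R (μ j))              ∎

  sumDiv-μ≈0 : ∀ {k} → 2 ≤ k → sumDiv R k (fromℤ R ∘ μ) ≈ 0#
  sumDiv-μ≈0 {k} 2≤k with ∃-prime-divisor 2≤k
  ... | p , prime[p] , p∣k = begin
    sumDiv R k (fromℤ R ∘ μ)                             ≈⟨ sumDiv≈sumTo k _ ⟩
    sumTo k H                                            ≈⟨ sumTo-cong k (λ {d} _ _ → when-split (does (p ∣? d)) (H d)) ⟩
    sumTo k (λ d → when (does (p ∣? d)) (H d) + H′ d)    ≈⟨ sumTo-+ k _ H′ ⟩
    sumTo k (λ d → when (does (p ∣? d)) (H d)) + sumTo k H′ ≈⟨ +-congʳ (sumTo-multiples k H (prime⇒1≤ prime[p]) H-beyond) ⟩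
    sumTo k (λ j → H (p ℕ.* j)) + sumTo k H′             ≈⟨ +-congʳ (sumTo-cong k (λ 1≤j _ → μ[p*j]-term prime[p] p∣k 1≤j)) ⟩
    sumTo k (λ j → - H′ j) + sumTo k H′                  ≈⟨ +-congʳ (sumTo-neg k H′) ⟩
    - sumTo k H′ + sumTo k H′                            ≈⟨ -‿inverseˡ _ ⟩
    0#                                                   ∎
    where
    H H′ : ℕ → Carrier
    H d = when (does (d ∣? k)) (fromℤ R (μ d))
    H′ d = when (not (does (p ∣? d))) (H d)
    H-beyond : ∀ {t} → k < t → H t ≈ 0#
    H-beyond k<t = when-no (_ ∣? k) (λ t∣k → ℕₚ.<⇒≱ k<t (∣⇒≤ {{ℕ.>-nonZero (ℕₚ.<-trans (s≤s z≤n) 2≤k)}} t∣k))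

  sumDiv-μ : ∀ k → sumDiv R k (fromℤ R ∘ μ) ≈ δ k
  sumDiv-μ zero          = refl
  sumDiv-μ (suc zero)    = trans (+-identityʳ _) (+-identityʳ _)
  sumDiv-μ (suc (suc k)) = sumDiv-μ≈0 {suc (suc k)} (s≤s (s≤s z≤n))

  μ⋆𝟙≈δ : ∀ k → ((fromℤ R ∘ μ) ⋆ 𝟙) k ≈ δ k
  μ⋆𝟙≈δ k = trans (sym (sumDiv≈⋆𝟙 k (fromℤ R ∘ μ))) (sumDiv-μ k)

  sumDivℤ-gcd≈𝟙⋆ : ∀ {k n} (f : ℕ → ℤ) → k ∣ n → fromℤ R (sumDivℤ (gcd k n) f) ≈ (𝟙 ⋆ (fromℤ R ∘ f)) k
  sumDivℤ-gcd≈𝟙⋆ {k} {n} f k∣n = begin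
    fromℤ R (sumDivℤ (gcd k n) f)   ≡⟨ ≡.cong (λ g → fromℤ R (sumDivℤ g f)) (gcd[k,n]≡k k∣n) ⟩
    fromℤ R (sumDivℤ k f)           ≈⟨ fromℤ-listSum (divisors k) f ⟩
    sumDiv R k (fromℤ R ∘ f)        ≈⟨ sumDiv≈⋆𝟙 k _ ⟩
    ((fromℤ R ∘ f) ⋆ 𝟙) k           ≈⟨ ⋆-comm k _ 𝟙 ⟩
    (𝟙 ⋆ (fromℤ R ∘ f)) k           ∎

  sumDiv-μ-inversion : ∀ {n} → 1 ≤ n → ∀ G A A′ → (∀ {k} → k ∣ n → A k ≈ (𝟙 ⋆ A′) k) →
    sumDiv R n (λ d → A (quot n d) * sumDiv R d (λ d′ → fromℤ R (μ (quot d d′)) * G d′)) ≈ (G ⋆ A′) n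
  sumDiv-μ-inversion {n} 1≤n G A A′ A≈𝟙⋆A′ = begin
    sumDiv R n (λ d → A (quot n d) * ψ d)        ≈⟨ listSum-cong (divisors n) (λ d → *-comm _ (ψ d)) ⟩
    sumDiv R n (λ d → ψ d * A (quot n d))        ≈⟨ sumDiv-⋆ n ψ A ⟩
    (ψ ⋆ A) n                                    ≈⟨ ⋆-cong n (λ {a} {b} ab≡n → *-cong (ψ≈G⋆μ a) (A≈𝟙⋆A′ (divides a (≡.sym ab≡n)))) ⟩
    ((G ⋆ μᴿ) ⋆ (𝟙 ⋆ A′)) n                      ≈⟨ ⋆-assoc n G μᴿ (𝟙 ⋆ A′) ⟩
    (G ⋆ (μᴿ ⋆ (𝟙 ⋆ A′))) n                      ≈⟨ ⋆-cong n (λ {a} {b} ab≡n → *-congˡ (cancel (1≤m*n⇒1≤n a (≡.subst (1 ≤_) (≡.sym ab≡n) 1≤n)))) ⟩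
    (G ⋆ A′) n                                   ∎
    where
    μᴿ = fromℤ R ∘ μ
    ψ : ℕ → Carrier
    ψ d = sumDiv R d (λ d′ → μᴿ (quot d d′) * G d′)
    ψ≈G⋆μ : ∀ d → ψ d ≈ (G ⋆ μᴿ) d
    ψ≈G⋆μ d = trans (listSum-cong (divisors d) (λ d′ → *-comm _ (G d′))) (sumDiv-⋆ d G μᴿ)
    cancel : ∀ {b} → 1 ≤ b → (μᴿ ⋆ (𝟙 ⋆ A′)) b ≈ A′ b
    cancel {b} 1≤b = begin
      (μᴿ ⋆ (𝟙 ⋆ A′)) b   ≈⟨ ⋆-assoc b μᴿ 𝟙 A′ ⟨
      ((μᴿ ⋆ 𝟙) ⋆ A′) b   ≈⟨ ⋆-cong b (λ {x} _ → *-congʳ (μ⋆𝟙≈δ x)) ⟩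
      (δ ⋆ A′) b          ≈⟨ ⋆-identityˡ A′ 1≤b ⟩
      A′ b                ∎

  module _ {n} (1≤n : 1 ≤ n) (e : ℕ → ℤ) (χ : ℕ → Carrier) where

    private
      E P χ₁ : ℕ → Carrier
      E d = fromℤ R (e (quot n d))
      P d = fromℤ R (+ d ℤ.* e d)
      χ₁ d = fromℕ R d * χ d

      mult≈𝟙⋆E : ∀ {k} → k ∣ n → fromℤ R (mult n e k) ≈ (𝟙 ⋆ E) k
      mult≈𝟙⋆E = sumDivℤ-gcd≈𝟙⋆ (λ d → e (quot n d))

      psum≈𝟙⋆P : ∀ {k} → k ∣ n → fromℤ R (psum n e k) ≈ (𝟙 ⋆ P) k
      psum≈𝟙⋆P = sumDivℤ-gcd≈𝟙⋆ (λ d → + d ℤ.* e d)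

      e[n/b]≡e[a] : ∀ {a b} → a ℕ.* b ≡ n → e (quot n b) ≡ e a
      e[n/b]≡e[a] {a} {b} ab≡n = ≡.cong e (quot-* (1≤m*n⇒1≤n a (≡.subst (1 ≤_) (≡.sym ab≡n) 1≤n)) (≡.trans (ℕₚ.*-comm b a) ab≡n))

      n/a≡b : ∀ {a b} → a ℕ.* b ≡ n → quot n a ≡ b
      n/a≡b {a} {b} ab≡n = quot-* (1≤m*n⇒1≤n b (≡.subst (1 ≤_) (≡.trans (≡.sym ab≡n) (ℕₚ.*-comm a b)) 1≤n)) ab≡n

    mult-φ₁₋ : sumDiv R n (λ d → fromℤ R (mult n e (quot n d)) * φ₁₋ R χ d)
               ≈ sumDiv R n (λ d → fromℕ R d * fromℤ R (e d) * χ d)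
    mult-φ₁₋ = begin
      sumDiv R n (λ d → fromℤ R (mult n e (quot n d)) * φ₁₋ R χ d) ≈⟨ sumDiv-μ-inversion 1≤n χ₁ _ E mult≈𝟙⋆E ⟩
      (χ₁ ⋆ E) n                                                   ≈⟨ ⋆-cong n (λ {a} {b} ab≡n → begin
        fromℕ R a * χ a * fromℤ R (e (quot n b))                       ≡⟨ ≡.cong (λ i → fromℕ R a * χ a * fromℤ R i) (e[n/b]≡e[a] ab≡n) ⟩
        fromℕ R a * χ a * fromℤ R (e a)                                ≈⟨ xy∙z≈xz∙y _ _ _ ⟩
        fromℕ R a * fromℤ R (e a) * χ a                                ≈⟨ *-identityʳ _ ⟨
        fromℕ R a * fromℤ R (e a) * χ a * 1#                           ∎) ⟩
      ((λ d → fromℕ R d * fromℤ R (e d) * χ d) ⋆ 𝟙) n               ≈⟨ sumDiv≈⋆𝟙 n _ ⟨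
      sumDiv R n (λ d → fromℕ R d * fromℤ R (e d) * χ d)           ∎

    psum-φ₁₋ : sumDiv R n (λ d → fromℤ R (psum n e (quot n d)) * φ₁₋ R χ d)
               ≈ fromℕ R n * sumDiv R n (λ d → fromℤ R (e (quot n d)) * χ d)
    psum-φ₁₋ = begin
      sumDiv R n (λ d → fromℤ R (psum n e (quot n d)) * φ₁₋ R χ d) ≈⟨ sumDiv-μ-inversion 1≤n χ₁ _ P psum≈𝟙⋆P ⟩
      (χ₁ ⋆ P) n                                                   ≈⟨ ⋆-cong n (λ {a} {b} ab≡n → begin
        fromℕ R a * χ a * fromℤ R (+ b ℤ.* e b)                        ≈⟨ *-congˡ (fromℤ-ℕ* b (e b)) ⟩
        fromℕ R a * χ a * (fromℕ R b * fromℤ R (e b))                  ≈⟨ interchange* _ _ _ _ ⟩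
        fromℕ R a * fromℕ R b * (χ a * fromℤ R (e b))                  ≈⟨ *-cong (×1-homo-* a b) (*-comm _ _) ⟨
        fromℕ R (a ℕ.* b) * (fromℤ R (e b) * χ a)                      ≡⟨ ≡.cong₂ (λ m i → fromℕ R m * (fromℤ R (e i) * χ a)) ab≡n (≡.sym (n/a≡b {a} ab≡n)) ⟩
        fromℕ R n * (fromℤ R (e (quot n a)) * χ a)                     ≈⟨ *-identityʳ _ ⟨
        fromℕ R n * (fromℤ R (e (quot n a)) * χ a) * 1#                ∎) ⟩
      ((λ d → fromℕ R n * (fromℤ R (e (quot n d)) * χ d)) ⋆ 𝟙) n   ≈⟨ sumDiv≈⋆𝟙 n _ ⟨
      sumDiv R n (λ d → fromℕ R n * (fromℤ R (e (quot n d)) * χ d)) ≈⟨ *-distribˡ-listSum (divisors n) _ _ ⟨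
      fromℕ R n * sumDiv R n (λ d → fromℤ R (e (quot n d)) * χ d)  ∎

    mult-φ₋ : sumDiv R n (λ d → fromℤ R (mult n e (quot n d)) * φ₋ R χ d)
              ≈ sumDiv R n (λ d → fromℤ R (e d) * χ d)
    mult-φ₋ = begin
      sumDiv R n (λ d → fromℤ R (mult n e (quot n d)) * φ₋ R χ d)  ≈⟨ sumDiv-μ-inversion 1≤n χ _ E mult≈𝟙⋆E ⟩
      (χ ⋆ E) n                                                    ≈⟨ ⋆-cong n (λ {a} {b} ab≡n → begin
        χ a * fromℤ R (e (quot n b))                                   ≡⟨ ≡.cong (λ i → χ a * fromℤ R i) (e[n/b]≡e[a] ab≡n) ⟩
        χ a * fromℤ R (e a)                                            ≈⟨ *-comm _ _ ⟩
        fromℤ R (e a) * χ a                                            ≈⟨ *-identityʳ _ ⟨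
        fromℤ R (e a) * χ a * 1#                                       ∎) ⟩
      ((λ d → fromℤ R (e d) * χ d) ⋆ 𝟙) n                          ≈⟨ sumDiv≈⋆𝟙 n _ ⟨
      sumDiv R n (λ d → fromℤ R (e d) * χ d)                       ∎

    psum-φ₋ : sumDiv R n (λ d → fromℤ R (psum n e (quot n d)) * φ₋ R χ d)
              ≈ sumDiv R n (λ d → fromℕ R (quot n d) * fromℤ R (e (quot n d)) * χ d)
    psum-φ₋ = begin
      sumDiv R n (λ d → fromℤ R (psum n e (quot n d)) * φ₋ R χ d)  ≈⟨ sumDiv-μ-inversion 1≤n χ _ P psum≈𝟙⋆P ⟩
      (χ ⋆ P) n                                                    ≈⟨ ⋆-cong n (λ {a} {b} ab≡n → begin
        χ a * fromℤ R (+ b ℤ.* e b)                                    ≈⟨ *-congˡ (fromℤ-ℕ* b (e b)) ⟩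
        χ a * (fromℕ R b * fromℤ R (e b))                              ≈⟨ *-comm _ _ ⟩
        fromℕ R b * fromℤ R (e b) * χ a                                ≡⟨ ≡.cong (λ i → fromℕ R i * fromℤ R (e i) * χ a) (≡.sym (n/a≡b {a} ab≡n)) ⟩
        fromℕ R (quot n a) * fromℤ R (e (quot n a)) * χ a              ≈⟨ *-identityʳ _ ⟨
        fromℕ R (quot n a) * fromℤ R (e (quot n a)) * χ a * 1#         ∎) ⟩
      ((λ d → fromℕ R (quot n d) * fromℤ R (e (quot n d)) * χ d) ⋆ 𝟙) n ≈⟨ sumDiv≈⋆𝟙 n _ ⟨
      sumDiv R n (λ d → fromℕ R (quot n d) * fromℤ R (e (quot n d)) * χ d) ∎

mainTheorem3 : ∀ {c ℓ : Level} (R : CommutativeRing c ℓ) (n : ℕ) → .{{NonZero n}} →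
  (e : ℕ → ℤ) → (χ : ℕ → CommutativeRing.Carrier R) → CompletelyMultiplicative R χ →
  let open CommutativeRing R in
    (sumDiv R n (λ d → fromℤ R (mult n e (quot n d)) * φ₁₋ R χ d)
       ≈ sumDiv R n (λ d → fromℕ R d * fromℤ R (e d) * χ d))
  × (sumDiv R n (λ d → fromℤ R (psum n e (quot n d)) * φ₁₋ R χ d)
       ≈ fromℕ R n * sumDiv R n (λ d → fromℤ R (e (quot n d)) * χ d))
  × (sumDiv R n (λ d → fromℤ R (mult n e (quot n d)) * φ₋ R χ d)
       ≈ sumDiv R n (λ d → fromℤ R (e d) * χ d))
  × (sumDiv R n (λ d → fromℤ R (psum n e (quot n d)) * φ₋ R χ d)
       ≈ sumDiv R n (λ d → fromℕ R (quot n d) * fromℤ R (e (quot n d)) * χ d))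
mainTheorem3 R n e χ _ = mult-φ₁₋ R 1≤n e χ , psum-φ₁₋ R 1≤n e χ , mult-φ₋ R 1≤n e χ , psum-φ₋ R 1≤n e χ
  where
  1≤n = ℕ.>-nonZero⁻¹ n
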